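{- Let $g(x)\in\mathbb{Z}[[x]]$ with $g(0)=1$ and let $h(x)=\mathbf{C}(g(x))$ be its central transform (defined in the context). Then $$g(x)=\frac{1}{\frac{1-x}{1+x}\,h\!\left(\frac{x}{(1+x)^2}\right)}.$$
   Context: For a power series $g(x)\in\mathbb{Z}[[x]]$ with $g(0)=1$, let $t_{n,k}=[x^n]\,\frac{1}{1-x}\,\frac{1}{g\left(\frac{x}{1-x}\right)}\left(\frac{x}{1-x}\right)^k$ for $n,k\ge0$, where $[x^n]$ extracts the coefficient of $x^n$. The central transform $\mathbf{C}(g(x))$ is the power series $\sum_{n\ge0}b_nx^n$ with $b_n=t_{2n,n}$. -}

module Defs where

open import Data.Nat using (ℕ; zero; suc; _∸_; _≡ᵇ_)
open import Data.Bool using (if_then_else_)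
open import Data.Integer using (ℤ; +_; _+_; _*_; -_; 0ℤ; 1ℤ)

-- Formal power series over ℤ, represented by their coefficient sequences:
-- f n is the coefficient [x^n] f.
PS : Set
PS = ℕ → ℤ

sumTo : ℕ → (ℕ → ℤ) → ℤ
sumTo zero    f = f 0
sumTo (suc n) f = sumTo n f + f (suc n)

sumFrom1 : ℕ → (ℕ → ℤ) → ℤ
sumFrom1 zero    f = 0ℤ
sumFrom1 (suc n) f = sumFrom1 n f + f (suc n)

const : ℤ → PS
const c zero    = c
const c (suc _) = 0ℤ

one : PS
one = const 1ℤ

X : PS
X 1 = 1ℤ
X _ = 0ℤ

oneMinusX : PS
oneMinusX 0 = 1ℤ
oneMinusX 1 = - 1ℤ
oneMinusX _ = 0ℤ

onePlusX : PS
onePlusX 0 = 1ℤ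
onePlusX 1 = 1ℤ
onePlusX _ = 0ℤ

_⊛_ : PS → PS → PS
(f ⊛ g) n = sumTo n (λ i → f i * g (n ∸ i))
infixl 7 _⊛_

pow : PS → ℕ → PS
pow f zero    = one
pow f (suc k) = pow f k ⊛ f

-- Multiplicative inverse 1/f of a series with f 0 = 1 (the only case used):
-- c 0 = 1,  c n = - Σ_{i=1}^{n} f i * c (n - i)  for n ≥ 1,
-- i.e. the unique c with f ⊛ c = 1 when f 0 = 1.
-- invUpTo f n is a sequence whose entries 0..n are c 0 .. c n.
invUpTo : PS → ℕ → PS
invUpTo f zero    = const 1ℤ
invUpTo f (suc n) m =
  if m ≡ᵇ suc n
  then - sumFrom1 (suc n) (λ i → f i * invUpTo f n (suc n ∸ i))
  else invUpTo f n m

inv : PS → PS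
inv f n = invUpTo f n n

-- Composition f(u(x)) for a series u with u 0 = 0:
-- [x^n] f(u) = Σ_{k=0}^{n} f k * [x^n] u^k   (higher k contribute nothing).
_∘ₚ_ : PS → PS → PS
(f ∘ₚ u) n = sumTo n (λ k → f k * pow u k n)

xOver1mx : PS
xOver1mx = X ⊛ inv oneMinusX

oneOver1mx : PS
oneOver1mx = inv oneMinusX

t : PS → ℕ → ℕ → ℤ
t g n k = (oneOver1mx ⊛ inv (g ∘ₚ xOver1mx) ⊛ pow xOver1mx k) n

central : PS → PS
central g n = t g (n Data.Nat.+ n) n

ratio : PS
ratio = oneMinusX ⊛ inv onePlusX

xOver1px² : PS
xOver1px² = X ⊛ inv (onePlusX ⊛ onePlusX)

-- Write a = 1/g. Substituting x/(1−x), the central transform becomes h_m = Σ_j a_j C(2m, m+j),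
-- which is [x^m] a(x)(1+x)^(2m); and s ↦ ([x^m] s(x)(1+x)^(2m))_m is injective, being triangular
-- with unit diagonal. For c = (1−x)/(1+x) · h(x/(1+x)^2), the weight of h_k in [x^m] c(x)(1+x)^(2m)
-- is [x^(m−k)] (1−x)(1+x)^(2(m−k)−1), which is 1 for k = m and 0 for k < m by the symmetry of
-- binomial coefficients. So c and a have the same image, hence c = a = 1/g and g = 1/c.

module Submission where

open import Defs
open import Algebra.Bundles using (CommutativeMonoid; CommutativeRing)
open import Data.Bool using (true; false)
open import Data.Integer using (ℤ; +_; _+_; _*_; -_; 0ℤ; 1ℤ; -1ℤ)
import Data.Integer.Properties as ℤₚ
open import Data.Nat as ℕ using (ℕ; zero; suc; _∸_; _≤_; _<_; z≤n; s≤s; _≡ᵇ_)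
open import Data.Nat.Combinatorics using (_C_; nCk+nC[k+1]≡[n+1]C[k+1]; nCk≡nC[n∸k]; k>n⇒nCk≡0)
import Data.Nat.Properties as ℕₚ
open import Data.Nat.Properties
  using (≤-refl; ≤-trans; ≤-reflexive; ≤-antisym; m≤n⇒m≤1+n; m<1+n⇒m≤n; m≤n⇒m<n∨m≡n; m<1+n⇒m<n∨m≡n; n≤1+n; m≤m+n; m∸n≤m;
         n∸n≡0; +-∸-assoc; m∸[m∸n]≡n; m+n∸m≡n; m+n∸n≡m; ∸-+-assoc; m+[n∸m]≡n; m≤n+m∸n; m≤n⇒∃[o]m+o≡n; +-monoʳ-<; +-monoʳ-≤; +-suc)
  renaming (+-comm to ℕ-+-comm; +-identityʳ to ℕ-+-identityʳ)
open import Data.Product using (_,_)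
open import Data.Sum using (inj₁; inj₂)
open import Relation.Binary.PropositionalEquality
open ≡-Reasoning

open import Algebra.Properties.CommutativeSemigroup ℤₚ.+-commutativeSemigroup using (interchange)
open import Algebra.Properties.CommutativeSemigroup ℕₚ.+-commutativeSemigroup using () renaming (interchange to ℕ-interchange)
open import Algebra.Properties.CommutativeSemigroup ℤₚ.*-commutativeSemigroup using (x∙yz≈y∙xz; xy∙z≈y∙xz)
open import Algebra.Properties.Group (CommutativeRing.+-group ℤₚ.+-*-commutativeRing) using (∙-cancelˡ)

-- Finite sums

sumTo-cong : ∀ n {F G : ℕ → ℤ} → (∀ i → i ≤ n → F i ≡ G i) → sumTo n F ≡ sumTo n G
sumTo-cong zero    F≡G = F≡G 0 z≤n
sumTo-cong (suc n) F≡G = cong₂ _+_ (sumTo-cong n (λ i i≤n → F≡G i (m≤n⇒m≤1+n i≤n))) (F≡G (suc n) ≤-refl)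

sumTo-0 : ∀ n (F : ℕ → ℤ) → (∀ i → i ≤ n → F i ≡ 0ℤ) → sumTo n F ≡ 0ℤ
sumTo-0 zero    F F≡0 = F≡0 0 z≤n
sumTo-0 (suc n) F F≡0 = cong₂ _+_ (sumTo-0 n F (λ i i≤n → F≡0 i (m≤n⇒m≤1+n i≤n))) (F≡0 (suc n) ≤-refl)

sumTo-+ : ∀ n (F G : ℕ → ℤ) → sumTo n (λ i → F i + G i) ≡ sumTo n F + sumTo n G
sumTo-+ zero    F G = refl
sumTo-+ (suc n) F G =
  trans (cong (_+ (F (suc n) + G (suc n))) (sumTo-+ n F G)) (interchange (sumTo n F) (sumTo n G) _ _)

*-distribˡ-sumTo : ∀ n c (F : ℕ → ℤ) → c * sumTo n F ≡ sumTo n (λ i → c * F i)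
*-distribˡ-sumTo zero    c F = refl
*-distribˡ-sumTo (suc n) c F =
  trans (ℤₚ.*-distribˡ-+ c (sumTo n F) _) (cong (_+ c * F (suc n)) (*-distribˡ-sumTo n c F))

*-distribʳ-sumTo : ∀ n c (F : ℕ → ℤ) → sumTo n F * c ≡ sumTo n (λ i → F i * c)
*-distribʳ-sumTo n c F = begin
  sumTo n F * c              ≡⟨ ℤₚ.*-comm (sumTo n F) c ⟩
  c * sumTo n F              ≡⟨ *-distribˡ-sumTo n c F ⟩
  sumTo n (λ i → c * F i)    ≡⟨ sumTo-cong n (λ i _ → ℤₚ.*-comm c (F i)) ⟩
  sumTo n (λ i → F i * c)    ∎

sumTo-extend : ∀ {m} M (F : ℕ → ℤ) → m ≤ M → (∀ i → m < i → i ≤ M → F i ≡ 0ℤ) →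
               sumTo m F ≡ sumTo M F
sumTo-extend M F m≤M tail≡0 with m≤n⇒m<n∨m≡n m≤M
... | inj₂ refl = refl
sumTo-extend {m} (suc M) F _ tail≡0 | inj₁ m<1+M = begin
  sumTo m F              ≡⟨ sumTo-extend M F (m<1+n⇒m≤n m<1+M) (λ i m<i i≤M → tail≡0 i m<i (m≤n⇒m≤1+n i≤M)) ⟩
  sumTo M F              ≡⟨ ℤₚ.+-identityʳ (sumTo M F) ⟨
  sumTo M F + 0ℤ         ≡⟨ cong (λ x → sumTo M F + x) (tail≡0 (suc M) m<1+M ≤-refl) ⟨
  sumTo (suc M) F        ∎

sumTo-last : ∀ n (F : ℕ → ℤ) → (∀ i → i < n → F i ≡ 0ℤ) → sumTo n F ≡ F n
sumTo-last zero    F init≡0 = refl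
sumTo-last (suc n) F init≡0 =
  trans (cong (_+ F (suc n)) (sumTo-0 n F (λ i i≤n → init≡0 i (s≤s i≤n)))) (ℤₚ.+-identityˡ (F (suc n)))

sumTo-suc-head : ∀ n (F : ℕ → ℤ) → sumTo (suc n) F ≡ F 0 + sumTo n (λ i → F (suc i))
sumTo-suc-head zero    F = refl
sumTo-suc-head (suc n) F =
  trans (cong (_+ F (suc (suc n))) (sumTo-suc-head n F)) (ℤₚ.+-assoc (F 0) _ _)

sumTo-reverse : ∀ n (F : ℕ → ℤ) → sumTo n F ≡ sumTo n (λ i → F (n ∸ i))
sumTo-reverse zero    F = refl
sumTo-reverse (suc n) F = begin
  sumTo (suc n) F                                        ≡⟨ sumTo-suc-head n F ⟩
  F 0 + sumTo n (λ i → F (suc i))                        ≡⟨ cong (λ x → F 0 + x) (sumTo-reverse n (λ i → F (suc i))) ⟩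
  F 0 + sumTo n (λ i → F (suc (n ∸ i)))                  ≡⟨ ℤₚ.+-comm (F 0) _ ⟩
  sumTo n (λ i → F (suc (n ∸ i))) + F 0                  ≡⟨ cong₂ _+_ (sumTo-cong n (λ i i≤n → sym (cong F (+-∸-assoc 1 i≤n))))
                                                                      (sym (cong F (n∸n≡0 n))) ⟩
  sumTo (suc n) (λ i → F (suc n ∸ i))                    ∎

sumTo-swap : ∀ n m (F : ℕ → ℕ → ℤ) →
             sumTo n (λ i → sumTo m (λ j → F i j)) ≡ sumTo m (λ j → sumTo n (λ i → F i j))
sumTo-swap zero    m F = refl
sumTo-swap (suc n) m F =
  trans (cong (_+ sumTo m (F (suc n))) (sumTo-swap n m F)) (sym (sumTo-+ m _ (F (suc n))))

sumTo-triangle : ∀ N (F : ℕ → ℕ → ℤ) →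
                 sumTo N (λ s → sumTo s (λ i → F i s)) ≡ sumTo N (λ i → sumTo (N ∸ i) (λ l → F i (i ℕ.+ l)))
sumTo-triangle zero    F = refl
sumTo-triangle (suc N) F = begin
  sumTo N (λ s → sumTo s (λ i → F i s)) + sumTo (suc N) (λ i → F i (suc N))
    ≡⟨ cong (_+ sumTo (suc N) (λ i → F i (suc N))) (sumTo-triangle N F) ⟩
  sumTo N Rows + (sumTo N (λ i → F i (suc N)) + F (suc N) (suc N))
    ≡⟨ ℤₚ.+-assoc (sumTo N Rows) _ _ ⟨
  (sumTo N Rows + sumTo N (λ i → F i (suc N))) + F (suc N) (suc N)
    ≡⟨ cong₂ _+_ (trans (sym (sumTo-+ N Rows _)) (sumTo-cong N extendRow)) lastRow ⟩
  sumTo (suc N) (λ i → sumTo (suc N ∸ i) (λ l → F i (i ℕ.+ l)))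
    ∎
  where
  Rows : ℕ → ℤ
  Rows i = sumTo (N ∸ i) (λ l → F i (i ℕ.+ l))
  extendRow : ∀ i → i ≤ N → Rows i + F i (suc N) ≡ sumTo (suc N ∸ i) (λ l → F i (i ℕ.+ l))
  extendRow i i≤N = begin
    Rows i + F i (suc N)                          ≡⟨ cong (λ k → Rows i + F i k) (sym (trans (+-suc i _) (cong suc (m+[n∸m]≡n i≤N)))) ⟩
    sumTo (suc (N ∸ i)) (λ l → F i (i ℕ.+ l))     ≡⟨ cong (λ k → sumTo k (λ l → F i (i ℕ.+ l))) (+-∸-assoc 1 i≤N) ⟨
    sumTo (suc N ∸ i) (λ l → F i (i ℕ.+ l))       ∎
  lastRow : F (suc N) (suc N) ≡ sumTo (suc N ∸ suc N) (λ l → F (suc N) (suc N ℕ.+ l))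
  lastRow = trans (cong (F (suc N)) (sym (ℕ-+-identityʳ (suc N))))
                  (cong (λ k → sumTo k (λ l → F (suc N) (suc N ℕ.+ l))) (sym (n∸n≡0 N)))

sumTo-sumFrom1 : ∀ n (F : ℕ → ℤ) → sumTo n F ≡ F 0 + sumFrom1 n F
sumTo-sumFrom1 zero    F = sym (ℤₚ.+-identityʳ (F 0))
sumTo-sumFrom1 (suc n) F = trans (cong (_+ F (suc n)) (sumTo-sumFrom1 n F)) (ℤₚ.+-assoc (F 0) _ _)

sumFrom1-cong : ∀ n {F G : ℕ → ℤ} → (∀ i → 1 ≤ i → i ≤ n → F i ≡ G i) → sumFrom1 n F ≡ sumFrom1 n G
sumFrom1-cong zero    F≡G = refl
sumFrom1-cong (suc n) F≡G =
  cong₂ _+_ (sumFrom1-cong n (λ i 1≤i i≤n → F≡G i 1≤i (m≤n⇒m≤1+n i≤n))) (F≡G (suc n) (s≤s z≤n) ≤-refl)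

-- The Cauchy product

⊛-cong : ∀ {f f′ g g′ : PS} → f ≗ f′ → g ≗ g′ → f ⊛ g ≗ f′ ⊛ g′
⊛-cong f≗f′ g≗g′ n = sumTo-cong n (λ i _ → cong₂ _*_ (f≗f′ i) (g≗g′ (n ∸ i)))

⊛-congˡ : ∀ f {g g′ : PS} → g ≗ g′ → f ⊛ g ≗ f ⊛ g′
⊛-congˡ f {g} {g′} = ⊛-cong {f} {f} {g} {g′} (λ _ → refl)

⊛-congʳ : ∀ {f f′ : PS} g → f ≗ f′ → f ⊛ g ≗ f′ ⊛ g
⊛-congʳ {f} {f′} g f≗f′ = ⊛-cong {f} {f′} {g} {g} f≗f′ (λ _ → refl)

⊛-comm : ∀ f g → f ⊛ g ≗ g ⊛ f
⊛-comm f g n = trans (sumTo-reverse n _) (sumTo-cong n (λ i i≤n →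
  trans (cong (λ k → f (n ∸ i) * g k) (m∸[m∸n]≡n i≤n)) (ℤₚ.*-comm (f (n ∸ i)) (g i))))

⊛-assoc : ∀ f g h → (f ⊛ g) ⊛ h ≗ f ⊛ (g ⊛ h)
⊛-assoc f g h N = begin
  sumTo N (λ s → sumTo s (λ i → f i * g (s ∸ i)) * h (N ∸ s))
    ≡⟨ sumTo-cong N (λ s _ → *-distribʳ-sumTo s (h (N ∸ s)) _) ⟩
  sumTo N (λ s → sumTo s (λ i → f i * g (s ∸ i) * h (N ∸ s)))
    ≡⟨ sumTo-triangle N (λ i s → f i * g (s ∸ i) * h (N ∸ s)) ⟩
  sumTo N (λ i → sumTo (N ∸ i) (λ l → f i * g (i ℕ.+ l ∸ i) * h (N ∸ (i ℕ.+ l))))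
    ≡⟨ sumTo-cong N (λ i _ → trans (sumTo-cong (N ∸ i) (λ l _ → reassociate i l)) (sym (*-distribˡ-sumTo (N ∸ i) (f i) _))) ⟩
  sumTo N (λ i → f i * sumTo (N ∸ i) (λ l → g l * h (N ∸ i ∸ l)))
    ∎
  where
  reassociate : ∀ i l → f i * g (i ℕ.+ l ∸ i) * h (N ∸ (i ℕ.+ l)) ≡ f i * (g l * h (N ∸ i ∸ l))
  reassociate i l = trans (cong₂ (λ a b → f i * g a * h b) (m+n∸m≡n i l) (sym (∸-+-assoc N i l)))
                          (ℤₚ.*-assoc (f i) _ _)

⊛-identityˡ : ∀ f → one ⊛ f ≗ f
⊛-identityˡ f zero    = ℤₚ.*-identityˡ (f 0)
⊛-identityˡ f (suc n) = begin
  (one ⊛ f) (suc n)                      ≡⟨ sumTo-suc-head n _ ⟩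
  1ℤ * f (suc n) + sumTo n (λ _ → 0ℤ)    ≡⟨ cong₂ _+_ (ℤₚ.*-identityˡ (f (suc n))) (sumTo-0 n _ (λ _ _ → refl)) ⟩
  f (suc n) + 0ℤ                         ≡⟨ ℤₚ.+-identityʳ (f (suc n)) ⟩
  f (suc n)                              ∎

⊛-identityʳ : ∀ f → f ⊛ one ≗ f
⊛-identityʳ f n = trans (⊛-comm f one n) (⊛-identityˡ f n)

⊛-commutativeMonoid : CommutativeMonoid _ _
⊛-commutativeMonoid = record
  { Carrier = PS ; _≈_ = _≗_ ; _∙_ = _⊛_ ; ε = one
  ; isCommutativeMonoid = record
    { isMonoid = record
      { isSemigroup = record
        { isMagma = record
          { isEquivalence = record { refl = λ _ → refl ; sym = λ p x → sym (p x) ; trans = λ p q x → trans (p x) (q x) }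
          ; ∙-cong = λ {f} {f′} {g} {g′} → ⊛-cong {f} {f′} {g} {g′} }
        ; assoc = ⊛-assoc }
      ; identity = ⊛-identityˡ , ⊛-identityʳ }
    ; comm = ⊛-comm } }

open import Algebra.Solver.CommutativeMonoid ⊛-commutativeMonoid using (solve; _⊜_; _⊕_)

X-⊛-suc : ∀ f n → (X ⊛ f) (suc n) ≡ f n
X-⊛-suc f n = begin
  (X ⊛ f) (suc n)                                  ≡⟨ sumTo-suc-head n _ ⟩
  0ℤ + sumTo n (λ i → X (suc i) * f (n ∸ i))       ≡⟨ ℤₚ.+-identityˡ _ ⟩
  sumTo n (λ i → X (suc i) * f (n ∸ i))            ≡⟨ sumTo-cong n (λ i _ → cong (_* f (n ∸ i)) (X-suc i)) ⟩
  (one ⊛ f) n                                      ≡⟨ ⊛-identityˡ f n ⟩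
  f n                                              ∎
  where
  X-suc : ∀ i → X (suc i) ≡ one i
  X-suc zero    = refl
  X-suc (suc i) = refl

pow-X-⊛ : ∀ n d F → (pow X n ⊛ F) (n ℕ.+ d) ≡ F d
pow-X-⊛ zero    d F = ⊛-identityˡ F d
pow-X-⊛ (suc n) d F = begin
  ((pow X n ⊛ X) ⊛ F) (suc n ℕ.+ d)     ≡⟨ ⊛-assoc (pow X n) X F (suc n ℕ.+ d) ⟩
  (pow X n ⊛ (X ⊛ F)) (suc (n ℕ.+ d))   ≡⟨ cong (pow X n ⊛ (X ⊛ F)) (+-suc n d) ⟨
  (pow X n ⊛ (X ⊛ F)) (n ℕ.+ suc d)     ≡⟨ pow-X-⊛ n (suc d) (X ⊛ F) ⟩
  (X ⊛ F) (suc d)                       ≡⟨ X-⊛-suc F d ⟩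
  F d                                   ∎

-- Triangularity: the m-th coefficient of s ⊛ W m involves s only up to index m, with weight W m 0 on s m.
⊛-diagonal-injective : (W : ℕ → PS) → (∀ m → W m 0 ≡ 1ℤ) →
                       ∀ s s′ → (∀ m → (s ⊛ W m) m ≡ (s′ ⊛ W m) m) → s ≗ s′
⊛-diagonal-injective W W0≡1 s s′ eq n = agreeBelow (suc n) n ≤-refl
  where
  scaled : ∀ (t : PS) m → t m * W m 0 ≡ t m
  scaled t m = trans (cong (t m *_) (W0≡1 m)) (ℤₚ.*-identityʳ (t m))

  prefix : PS → ℕ → ℤ
  prefix t k = sumTo k (λ i → t i * W (suc k) (suc k ∸ i))

  split : ∀ (t : PS) k → (t ⊛ W (suc k)) (suc k) ≡ prefix t k + t (suc k) * W (suc k) 0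
  split t k = cong (λ j → prefix t k + t (suc k) * W (suc k) j) (n∸n≡0 k)

  agreeAt : ∀ m → (∀ i → i < m → s i ≡ s′ i) → s m ≡ s′ m
  agreeAt zero    _     = trans (sym (scaled s 0)) (trans (eq 0) (scaled s′ 0))
  agreeAt (suc k) below = begin
    s (suc k)                  ≡⟨ scaled s (suc k) ⟨
    s (suc k) * W (suc k) 0    ≡⟨ ∙-cancelˡ (prefix s k) _ _ sameLast ⟩
    s′ (suc k) * W (suc k) 0   ≡⟨ scaled s′ (suc k) ⟩
    s′ (suc k)                 ∎
    where
    samePrefix : prefix s k ≡ prefix s′ k
    samePrefix = sumTo-cong k (λ i i≤k → cong (_* W (suc k) (suc k ∸ i)) (below i (s≤s i≤k)))
    sameLast : prefix s k + s (suc k) * W (suc k) 0 ≡ prefix s k + s′ (suc k) * W (suc k) 0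
    sameLast = begin
      prefix s k + s (suc k) * W (suc k) 0      ≡⟨ split s k ⟨
      (s ⊛ W (suc k)) (suc k)                   ≡⟨ eq (suc k) ⟩
      (s′ ⊛ W (suc k)) (suc k)                  ≡⟨ split s′ k ⟩
      prefix s′ k + s′ (suc k) * W (suc k) 0    ≡⟨ cong (_+ s′ (suc k) * W (suc k) 0) samePrefix ⟨
      prefix s k + s′ (suc k) * W (suc k) 0     ∎

  agreeBelow : ∀ m i → i < m → s i ≡ s′ i
  agreeBelow (suc m) i i<1+m with m<1+n⇒m<n∨m≡n i<1+m
  ... | inj₁ i<m  = agreeBelow m i i<m
  ... | inj₂ refl = agreeAt i (agreeBelow i)

-- Multiplicative inverses

≡ᵇ-refl : ∀ n → (n ≡ᵇ n) ≡ true
≡ᵇ-refl zero    = refl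
≡ᵇ-refl (suc n) = ≡ᵇ-refl n

<⇒≡ᵇ-false : ∀ {m n} → m < n → (m ≡ᵇ n) ≡ false
<⇒≡ᵇ-false {zero}  {suc n} _         = refl
<⇒≡ᵇ-false {suc m} {suc n} (s≤s m<n) = <⇒≡ᵇ-false m<n

invUpTo-stable : ∀ f n m → m ≤ n → invUpTo f n m ≡ inv f m
invUpTo-stable f zero    zero _   = refl
invUpTo-stable f (suc n) m   m≤1+n with m≤n⇒m<n∨m≡n m≤1+n
... | inj₂ refl         = refl
... | inj₁ (s≤s m≤n) rewrite <⇒≡ᵇ-false (s≤s m≤n) = invUpTo-stable f n m m≤n

inv-suc : ∀ f n → inv f (suc n) ≡ - sumFrom1 (suc n) (λ i → f i * inv f (suc n ∸ i))
inv-suc f n rewrite ≡ᵇ-refl n =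
  cong -_ (sumFrom1-cong (suc n) (λ { (suc i) _ _ → cong (f (suc i) *_) (invUpTo-stable f n (n ∸ i) (m∸n≤m n i)) }))

⊛-inverseʳ : ∀ f → f 0 ≡ 1ℤ → f ⊛ inv f ≗ one
⊛-inverseʳ f f0≡1 zero    = cong (_* 1ℤ) f0≡1
⊛-inverseʳ f f0≡1 (suc n) = begin
  (f ⊛ inv f) (suc n)                ≡⟨ sumTo-sumFrom1 (suc n) _ ⟩
  f 0 * inv f (suc n) + S            ≡⟨ cong (λ c → c * inv f (suc n) + S) f0≡1 ⟩
  1ℤ * inv f (suc n) + S             ≡⟨ cong (_+ S) (trans (ℤₚ.*-identityˡ (inv f (suc n))) (inv-suc f n)) ⟩
  - S + S                            ≡⟨ ℤₚ.+-inverseˡ S ⟩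
  0ℤ                                 ∎
  where
  S : ℤ
  S = sumFrom1 (suc n) (λ i → f i * inv f (suc n ∸ i))

⊛-inverseˡ : ∀ f → f 0 ≡ 1ℤ → inv f ⊛ f ≗ one
⊛-inverseˡ f f0≡1 n = trans (⊛-comm (inv f) f n) (⊛-inverseʳ f f0≡1 n)

inv-unique : ∀ f c → f 0 ≡ 1ℤ → f ⊛ c ≗ one → c ≗ inv f
inv-unique f c f0≡1 f⊛c≗one = ⊛-diagonal-injective (λ _ → f) (λ _ → f0≡1) c (inv f) (λ m → begin
  (c ⊛ f) m        ≡⟨ ⊛-comm c f m ⟩
  (f ⊛ c) m        ≡⟨ f⊛c≗one m ⟩
  one m            ≡⟨ ⊛-inverseˡ f f0≡1 m ⟨
  (inv f ⊛ f) m    ∎)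

-- Powers and composition

pow-cong : ∀ {u v : PS} → u ≗ v → ∀ k → pow u k ≗ pow v k
pow-cong         u≗v zero    _ = refl
pow-cong {u} {v} u≗v (suc k)   = ⊛-cong {pow u k} {pow v k} {u} {v} (pow-cong u≗v k) u≗v

pow-+ : ∀ u a b → pow u (a ℕ.+ b) ≗ pow u a ⊛ pow u b
pow-+ u a zero    n = trans (cong (λ k → pow u k n) (ℕ-+-identityʳ a)) (sym (⊛-identityʳ (pow u a) n))
pow-+ u a (suc b) n = begin
  pow u (a ℕ.+ suc b) n           ≡⟨ cong (λ k → pow u k n) (+-suc a b) ⟩
  (pow u (a ℕ.+ b) ⊛ u) n         ≡⟨ ⊛-congʳ u (pow-+ u a b) n ⟩
  ((pow u a ⊛ pow u b) ⊛ u) n     ≡⟨ ⊛-assoc (pow u a) (pow u b) u n ⟩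
  (pow u a ⊛ pow u (suc b)) n     ∎

pow-⊛ : ∀ f g n → pow (f ⊛ g) n ≗ pow f n ⊛ pow g n
pow-⊛ f g zero    k = sym (⊛-identityˡ one k)
pow-⊛ f g (suc n) k = begin
  (pow (f ⊛ g) n ⊛ (f ⊛ g)) k          ≡⟨ ⊛-congʳ (f ⊛ g) (pow-⊛ f g n) k ⟩
  ((pow f n ⊛ pow g n) ⊛ (f ⊛ g)) k    ≡⟨ solve 4 (λ a b c d → (a ⊕ b) ⊕ (c ⊕ d) ⊜ (a ⊕ c) ⊕ (b ⊕ d)) (λ _ → refl) (pow f n) (pow g n) f g k ⟩
  ((pow f n ⊛ f) ⊛ (pow g n ⊛ g)) k    ∎

pow-coeff-< : ∀ u → u 0 ≡ 0ℤ → ∀ k n → n < k → pow u k n ≡ 0ℤ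
pow-coeff-< u u0≡0 (suc k) n (s≤s n≤k) = sumTo-0 n _ term≡0
  where
  term≡0 : ∀ i → i ≤ n → pow u k i * u (n ∸ i) ≡ 0ℤ
  term≡0 i i≤n with m≤n⇒m<n∨m≡n (≤-trans i≤n n≤k)
  ... | inj₁ i<k  = trans (cong (_* u (n ∸ i)) (pow-coeff-< u u0≡0 k i i<k)) (ℤₚ.*-zeroˡ (u (n ∸ i)))
  ... | inj₂ refl = trans (cong (λ j → pow u i i * u j) (trans (cong (_∸ i) (≤-antisym n≤k i≤n)) (n∸n≡0 i)))
                          (trans (cong (pow u i i *_) u0≡0) (ℤₚ.*-zeroʳ (pow u i i)))

∘ₚ-congˡ : ∀ {f f′ : PS} u → f ≗ f′ → f ∘ₚ u ≗ f′ ∘ₚ u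
∘ₚ-congˡ u f≗f′ n = sumTo-cong n (λ k _ → cong (_* pow u k n) (f≗f′ k))

-- u^j has order j, so the terms j > N − i of each inner sum vanish and all inner sums may run up to N.
⊛-∘ₚ : ∀ u → u 0 ≡ 0ℤ → ∀ P f N → (P ⊛ (f ∘ₚ u)) N ≡ sumTo N (λ j → f j * (P ⊛ pow u j) N)
⊛-∘ₚ u u0≡0 P f N = begin
  sumTo N (λ i → P i * sumTo (N ∸ i) (λ j → f j * pow u j (N ∸ i)))
    ≡⟨ sumTo-cong N (λ i _ → cong (P i *_) (sumTo-extend N _ (m∸n≤m N i) (λ j N∸i<j _ →
         trans (cong (f j *_) (pow-coeff-< u u0≡0 j (N ∸ i) N∸i<j)) (ℤₚ.*-zeroʳ (f j))))) ⟩
  sumTo N (λ i → P i * sumTo N (λ j → f j * pow u j (N ∸ i)))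
    ≡⟨ sumTo-cong N (λ i _ → *-distribˡ-sumTo N (P i) _) ⟩
  sumTo N (λ i → sumTo N (λ j → P i * (f j * pow u j (N ∸ i))))
    ≡⟨ sumTo-swap N N _ ⟩
  sumTo N (λ j → sumTo N (λ i → P i * (f j * pow u j (N ∸ i))))
    ≡⟨ sumTo-cong N (λ j _ → trans (sumTo-cong N (λ i _ → x∙yz≈y∙xz (P i) (f j) _)) (sym (*-distribˡ-sumTo N (f j) _))) ⟩
  sumTo N (λ j → f j * (P ⊛ pow u j) N)
    ∎

∘ₚ-⊛-double-sum : ∀ u → u 0 ≡ 0ℤ → ∀ f g N →
  ((f ⊛ g) ∘ₚ u) N ≡ sumTo N (λ i → sumTo N (λ l → f i * g l * pow u (i ℕ.+ l) N))
∘ₚ-⊛-double-sum u u0≡0 f g N = begin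
  sumTo N (λ s → sumTo s (λ i → f i * g (s ∸ i)) * pow u s N)
    ≡⟨ sumTo-cong N (λ s _ → *-distribʳ-sumTo s (pow u s N) _) ⟩
  sumTo N (λ s → sumTo s (λ i → f i * g (s ∸ i) * pow u s N))
    ≡⟨ sumTo-triangle N (λ i s → f i * g (s ∸ i) * pow u s N) ⟩
  sumTo N (λ i → sumTo (N ∸ i) (λ l → f i * g (i ℕ.+ l ∸ i) * pow u (i ℕ.+ l) N))
    ≡⟨ sumTo-cong N (λ i _ → trans (sumTo-cong (N ∸ i) (λ l _ → cong (λ j → f i * g j * pow u (i ℕ.+ l) N) (m+n∸m≡n i l)))
                                   (sumTo-extend N _ (m∸n≤m N i) (λ l N∸i<l _ → high-order-term≡0 i l N∸i<l))) ⟩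
  sumTo N (λ i → sumTo N (λ l → f i * g l * pow u (i ℕ.+ l) N))
    ∎
  where
  high-order-term≡0 : ∀ i l → N ∸ i < l → f i * g l * pow u (i ℕ.+ l) N ≡ 0ℤ
  high-order-term≡0 i l N∸i<l = trans (cong (f i * g l *_) (pow-coeff-< u u0≡0 (i ℕ.+ l) N N<i+l)) (ℤₚ.*-zeroʳ (f i * g l))
    where
    N<i+l : N < i ℕ.+ l
    N<i+l = ≤-trans (s≤s (m≤n+m∸n N i)) (≤-trans (≤-reflexive (sym (+-suc i (N ∸ i)))) (+-monoʳ-≤ i N∸i<l))

∘ₚ-homo-⊛ : ∀ u → u 0 ≡ 0ℤ → ∀ f g → (f ⊛ g) ∘ₚ u ≗ (f ∘ₚ u) ⊛ (g ∘ₚ u)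
∘ₚ-homo-⊛ u u0≡0 f g N = begin
  ((f ⊛ g) ∘ₚ u) N
    ≡⟨ ∘ₚ-⊛-double-sum u u0≡0 f g N ⟩
  sumTo N (λ i → sumTo N (λ l → f i * g l * pow u (i ℕ.+ l) N))
    ≡⟨ sumTo-swap N N _ ⟩
  sumTo N (λ l → sumTo N (λ i → f i * g l * pow u (i ℕ.+ l) N))
    ≡⟨ sumTo-cong N (λ l _ → trans (sumTo-cong N (λ i _ → regroup i l)) (sym (*-distribˡ-sumTo N (g l) _))) ⟩
  sumTo N (λ l → g l * sumTo N (λ i → f i * (pow u l ⊛ pow u i) N))
    ≡⟨ sumTo-cong N (λ l _ → cong (g l *_) (trans (sym (⊛-∘ₚ u u0≡0 (pow u l) f N)) (⊛-comm (pow u l) (f ∘ₚ u) N))) ⟩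
  sumTo N (λ l → g l * ((f ∘ₚ u) ⊛ pow u l) N)
    ≡⟨ ⊛-∘ₚ u u0≡0 (f ∘ₚ u) g N ⟨
  ((f ∘ₚ u) ⊛ (g ∘ₚ u)) N
    ∎
  where
  regroup : ∀ i l → f i * g l * pow u (i ℕ.+ l) N ≡ g l * (f i * (pow u l ⊛ pow u i) N)
  regroup i l = trans (xy∙z≈y∙xz (f i) (g l) _)
                      (cong (λ c → g l * (f i * c)) (trans (cong (λ k → pow u k N) (ℕ-+-comm i l)) (pow-+ u l i N)))

one-∘ₚ : ∀ u → one ∘ₚ u ≗ one
one-∘ₚ u N = trans (sym (sumTo-extend N _ z≤n (λ { (suc i) _ _ → refl }))) (ℤₚ.*-identityˡ (pow u 0 N))

inv-∘ₚ : ∀ u → u 0 ≡ 0ℤ → ∀ g → g 0 ≡ 1ℤ → inv (g ∘ₚ u) ≗ inv g ∘ₚ u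
inv-∘ₚ u u0≡0 g g0≡1 n = sym (inv-unique (g ∘ₚ u) (inv g ∘ₚ u) (trans (ℤₚ.*-identityʳ (g 0)) g0≡1) (λ m → begin
  ((g ∘ₚ u) ⊛ (inv g ∘ₚ u)) m    ≡⟨ ∘ₚ-homo-⊛ u u0≡0 g (inv g) m ⟨
  ((g ⊛ inv g) ∘ₚ u) m           ≡⟨ ∘ₚ-congˡ u (⊛-inverseʳ g g0≡1) m ⟩
  (one ∘ₚ u) m                   ≡⟨ one-∘ₚ u m ⟩
  one m                          ∎) n)

-- Binomial coefficients

linear-⊛-suc : ∀ L F → (∀ k → L (suc (suc k)) ≡ 0ℤ) → ∀ k → (L ⊛ F) (suc k) ≡ L 0 * F (suc k) + L 1 * F k
linear-⊛-suc L F L≥2≡0 k = trans (sumTo-suc-head k _) (cong (λ c → L 0 * F (suc k) + c) (tail k))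
  where
  tail : ∀ k → sumTo k (λ i → L (suc i) * F (k ∸ i)) ≡ L 1 * F k
  tail zero    = refl
  tail (suc k) = begin
    sumTo (suc k) (λ i → L (suc i) * F (suc k ∸ i))          ≡⟨ sumTo-suc-head k _ ⟩
    L 1 * F (suc k) + sumTo k (λ i → L (suc (suc i)) * F (k ∸ i))
      ≡⟨ cong (λ c → L 1 * F (suc k) + c) (sumTo-0 k _ (λ i _ → trans (cong (_* F (k ∸ i)) (L≥2≡0 i)) (ℤₚ.*-zeroˡ (F (k ∸ i))))) ⟩
    L 1 * F (suc k) + 0ℤ                                     ≡⟨ ℤₚ.+-identityʳ _ ⟩
    L 1 * F (suc k)                                          ∎

pow-onePlusX : ∀ n k → pow onePlusX n k ≡ + (n C k)
pow-onePlusX zero    zero    = refl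
pow-onePlusX zero    (suc k) = refl
pow-onePlusX (suc n) zero    = trans (ℤₚ.*-identityʳ (pow onePlusX n 0)) (pow-onePlusX n 0)
pow-onePlusX (suc n) (suc k) = begin
  (pow onePlusX n ⊛ onePlusX) (suc k)                      ≡⟨ ⊛-comm (pow onePlusX n) onePlusX (suc k) ⟩
  (onePlusX ⊛ pow onePlusX n) (suc k)                      ≡⟨ linear-⊛-suc onePlusX (pow onePlusX n) (λ _ → refl) k ⟩
  1ℤ * pow onePlusX n (suc k) + 1ℤ * pow onePlusX n k      ≡⟨ cong₂ _+_ (ℤₚ.*-identityˡ (pow onePlusX n (suc k))) (ℤₚ.*-identityˡ (pow onePlusX n k)) ⟩
  pow onePlusX n (suc k) + pow onePlusX n k                ≡⟨ cong₂ _+_ (pow-onePlusX n (suc k)) (pow-onePlusX n k) ⟩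
  + (n C suc k ℕ.+ n C k)                                  ≡⟨ cong +_ (trans (ℕ-+-comm (n C suc k) _) (nCk+nC[k+1]≡[n+1]C[k+1] n k)) ⟩
  + (suc n C suc k)                                        ∎

oneOver1mx-coeff : ∀ n → oneOver1mx n ≡ 1ℤ
oneOver1mx-coeff n = sym (inv-unique oneMinusX (λ _ → 1ℤ) refl oneMinusX⊛ones n)
  where
  oneMinusX⊛ones : oneMinusX ⊛ (λ _ → 1ℤ) ≗ one
  oneMinusX⊛ones zero    = refl
  oneMinusX⊛ones (suc k) = linear-⊛-suc oneMinusX (λ _ → 1ℤ) (λ _ → refl) k

⊛-xOver1mx-suc : ∀ F n → (F ⊛ xOver1mx) (suc n) ≡ sumTo n F
⊛-xOver1mx-suc F n = begin
  sumTo n (λ i → F i * xOver1mx (suc n ∸ i)) + F (suc n) * xOver1mx (suc n ∸ suc n)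
    ≡⟨ cong₂ _+_ (sumTo-cong n (λ i i≤n → trans (cong (λ j → F i * xOver1mx j) (+-∸-assoc 1 i≤n))
                                                (trans (cong (F i *_) (xOver1mx-suc (n ∸ i))) (ℤₚ.*-identityʳ (F i)))))
                 (trans (cong (λ j → F (suc n) * xOver1mx j) (n∸n≡0 n)) (ℤₚ.*-zeroʳ (F (suc n)))) ⟩
  sumTo n F + 0ℤ
    ≡⟨ ℤₚ.+-identityʳ _ ⟩
  sumTo n F
    ∎
  where
  xOver1mx-suc : ∀ n → xOver1mx (suc n) ≡ 1ℤ
  xOver1mx-suc n = trans (X-⊛-suc oneOver1mx n) (oneOver1mx-coeff n)

hockey-stick : ∀ r n → sumTo n (λ i → + (i C r)) ≡ + (suc n C suc r)
hockey-stick r zero    = cong +_ (trans (sym (ℕ-+-identityʳ (0 C r))) (nCk+nC[k+1]≡[n+1]C[k+1] 0 r))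
hockey-stick r (suc n) = begin
  sumTo n (λ i → + (i C r)) + + (suc n C r)    ≡⟨ cong (_+ + (suc n C r)) (hockey-stick r n) ⟩
  + (suc n C suc r) + + (suc n C r)            ≡⟨ ℤₚ.+-comm (+ (suc n C suc r)) (+ (suc n C r)) ⟩
  + (suc n C r ℕ.+ suc n C suc r)              ≡⟨ cong +_ (nCk+nC[k+1]≡[n+1]C[k+1] (suc n) r) ⟩
  + (suc (suc n) C suc r)                      ∎

oneOver1mx-⊛-pow : ∀ r N → (oneOver1mx ⊛ pow xOver1mx r) N ≡ + (N C r)
oneOver1mx-⊛-pow zero    N = trans (⊛-identityʳ oneOver1mx N) (oneOver1mx-coeff N)
oneOver1mx-⊛-pow (suc r) N = trans (sym (⊛-assoc oneOver1mx (pow xOver1mx r) xOver1mx N)) (shifted N)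
  where
  shifted : ∀ N → ((oneOver1mx ⊛ pow xOver1mx r) ⊛ xOver1mx) N ≡ + (N C suc r)
  shifted zero    = ℤₚ.*-zeroʳ ((oneOver1mx ⊛ pow xOver1mx r) 0)
  shifted (suc n) = begin
    ((oneOver1mx ⊛ pow xOver1mx r) ⊛ xOver1mx) (suc n)     ≡⟨ ⊛-xOver1mx-suc (oneOver1mx ⊛ pow xOver1mx r) n ⟩
    sumTo n (oneOver1mx ⊛ pow xOver1mx r)                  ≡⟨ sumTo-cong n (λ i _ → oneOver1mx-⊛-pow r i) ⟩
    sumTo n (λ i → + (i C r))                              ≡⟨ hockey-stick r n ⟩
    + (suc n C suc r)                                      ∎

-- The central transform

central-as-sum : ∀ g → g 0 ≡ 1ℤ → ∀ m → central g m ≡ sumTo (m ℕ.+ m) (λ j → inv g j * + ((m ℕ.+ m) C (m ℕ.+ j)))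
central-as-sum g g0≡1 m = begin
  ((oneOver1mx ⊛ inv (g ∘ₚ xOver1mx)) ⊛ pow xOver1mx m) M
    ≡⟨ ⊛-congʳ (pow xOver1mx m) (⊛-congˡ oneOver1mx (inv-∘ₚ xOver1mx refl g g0≡1)) M ⟩
  ((oneOver1mx ⊛ (inv g ∘ₚ xOver1mx)) ⊛ pow xOver1mx m) M
    ≡⟨ solve 3 (λ o a w → (o ⊕ a) ⊕ w ⊜ (w ⊕ o) ⊕ a) (λ _ → refl) oneOver1mx (inv g ∘ₚ xOver1mx) (pow xOver1mx m) M ⟩
  ((pow xOver1mx m ⊛ oneOver1mx) ⊛ (inv g ∘ₚ xOver1mx)) M
    ≡⟨ ⊛-∘ₚ xOver1mx refl (pow xOver1mx m ⊛ oneOver1mx) (inv g) M ⟩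
  sumTo M (λ j → inv g j * ((pow xOver1mx m ⊛ oneOver1mx) ⊛ pow xOver1mx j) M)
    ≡⟨ sumTo-cong M (λ j _ → cong (inv g j *_) (trans (regroup j) (oneOver1mx-⊛-pow (m ℕ.+ j) M))) ⟩
  sumTo M (λ j → inv g j * + (M C (m ℕ.+ j)))
    ∎
  where
  M : ℕ
  M = m ℕ.+ m
  regroup : ∀ j → ((pow xOver1mx m ⊛ oneOver1mx) ⊛ pow xOver1mx j) M ≡ (oneOver1mx ⊛ pow xOver1mx (m ℕ.+ j)) M
  regroup j = trans (solve 3 (λ w o v → (w ⊕ o) ⊕ v ⊜ o ⊕ (w ⊕ v)) (λ _ → refl) (pow xOver1mx m) oneOver1mx (pow xOver1mx j) M)
                    (⊛-congˡ oneOver1mx (λ k → sym (pow-+ xOver1mx m j k)) M)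

centralCoeff : PS → PS
centralCoeff s m = (s ⊛ pow onePlusX (m ℕ.+ m)) m

centralCoeff-as-sum : ∀ s m → centralCoeff s m ≡ sumTo (m ℕ.+ m) (λ j → s j * + ((m ℕ.+ m) C (m ℕ.+ j)))
centralCoeff-as-sum s m = begin
  sumTo m (λ i → s i * pow onePlusX (m ℕ.+ m) (m ∸ i))
    ≡⟨ sumTo-cong m (λ i i≤m → cong (s i *_) (trans (pow-onePlusX (m ℕ.+ m) (m ∸ i)) (cong +_ (symmetric i i≤m)))) ⟩
  sumTo m (λ i → s i * + ((m ℕ.+ m) C (m ℕ.+ i)))
    ≡⟨ sumTo-extend (m ℕ.+ m) _ (m≤m+n m m) (λ i m<i _ → trans (cong (λ c → s i * + c) (k>n⇒nCk≡0 (+-monoʳ-< m m<i))) (ℤₚ.*-zeroʳ (s i))) ⟩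
  sumTo (m ℕ.+ m) (λ j → s j * + ((m ℕ.+ m) C (m ℕ.+ j)))
    ∎
  where
  symmetric : ∀ i → i ≤ m → (m ℕ.+ m) C (m ∸ i) ≡ (m ℕ.+ m) C (m ℕ.+ i)
  symmetric i i≤m = trans (nCk≡nC[n∸k] (≤-trans (m∸n≤m m i) (m≤m+n m m)))
    (cong ((m ℕ.+ m) C_) (trans (+-∸-assoc m (m∸n≤m m i)) (cong (m ℕ.+_) (m∸[m∸n]≡n i≤m))))

central≗centralCoeff∘inv : ∀ g → g 0 ≡ 1ℤ → central g ≗ centralCoeff (inv g)
central≗centralCoeff∘inv g g0≡1 m = trans (central-as-sum g g0≡1 m) (sym (centralCoeff-as-sum (inv g) m))

centralCoeff-injective : ∀ s s′ → centralCoeff s ≗ centralCoeff s′ → s ≗ s′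
centralCoeff-injective = ⊛-diagonal-injective (λ m → pow onePlusX (m ℕ.+ m)) (λ m → pow-onePlusX (m ℕ.+ m) 0)

onePlusX² : PS
onePlusX² = onePlusX ⊛ onePlusX

xOver1px²-⊛-square : xOver1px² ⊛ onePlusX² ≗ X
xOver1px²-⊛-square k = begin
  ((X ⊛ inv onePlusX²) ⊛ onePlusX²) k    ≡⟨ ⊛-assoc X (inv onePlusX²) onePlusX² k ⟩
  (X ⊛ (inv onePlusX² ⊛ onePlusX²)) k    ≡⟨ ⊛-congˡ X (⊛-inverseˡ onePlusX² refl) k ⟩
  (X ⊛ one) k                            ≡⟨ ⊛-identityʳ X k ⟩
  X k                                    ∎

pow-onePlusX-+ : ∀ n d → pow onePlusX ((n ℕ.+ d) ℕ.+ (n ℕ.+ d)) ≗ pow onePlusX² n ⊛ pow onePlusX (d ℕ.+ d)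
pow-onePlusX-+ n d k = begin
  pow onePlusX ((n ℕ.+ d) ℕ.+ (n ℕ.+ d)) k                     ≡⟨ cong (λ e → pow onePlusX e k) (ℕ-interchange n d n d) ⟩
  pow onePlusX ((n ℕ.+ n) ℕ.+ (d ℕ.+ d)) k                     ≡⟨ pow-+ onePlusX (n ℕ.+ n) (d ℕ.+ d) k ⟩
  (pow onePlusX (n ℕ.+ n) ⊛ pow onePlusX (d ℕ.+ d)) k          ≡⟨ ⊛-congʳ (pow onePlusX (d ℕ.+ d)) square k ⟩
  (pow onePlusX² n ⊛ pow onePlusX (d ℕ.+ d)) k                 ∎
  where
  square : pow onePlusX (n ℕ.+ n) ≗ pow onePlusX² n
  square j = trans (pow-+ onePlusX n n j) (sym (pow-⊛ onePlusX onePlusX n j))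

-- Multiplying by (1 + x)^(2n) turns (x/(1+x)^2)^n into x^n.
ratio-⊛-pow-shift : ∀ n d →
  (pow onePlusX ((n ℕ.+ d) ℕ.+ (n ℕ.+ d)) ⊛ ratio) ⊛ pow xOver1px² n ≗ pow X n ⊛ (ratio ⊛ pow onePlusX (d ℕ.+ d))
ratio-⊛-pow-shift n d k = begin
  ((pow onePlusX ((n ℕ.+ d) ℕ.+ (n ℕ.+ d)) ⊛ ratio) ⊛ pow xOver1px² n) k
    ≡⟨ ⊛-congʳ (pow xOver1px² n) (⊛-congʳ ratio (pow-onePlusX-+ n d)) k ⟩
  (((pow onePlusX² n ⊛ pow onePlusX (d ℕ.+ d)) ⊛ ratio) ⊛ pow xOver1px² n) k
    ≡⟨ solve 4 (λ a b r y → ((a ⊕ b) ⊕ r) ⊕ y ⊜ (y ⊕ a) ⊕ (r ⊕ b)) (λ _ → refl) (pow onePlusX² n) (pow onePlusX (d ℕ.+ d)) ratio (pow xOver1px² n) k ⟩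
  ((pow xOver1px² n ⊛ pow onePlusX² n) ⊛ (ratio ⊛ pow onePlusX (d ℕ.+ d))) k
    ≡⟨ ⊛-congʳ (ratio ⊛ pow onePlusX (d ℕ.+ d)) (λ j → trans (sym (pow-⊛ xOver1px² onePlusX² n j)) (pow-cong xOver1px²-⊛-square n j)) k ⟩
  (pow X n ⊛ (ratio ⊛ pow onePlusX (d ℕ.+ d))) k
    ∎

-- (1 − x)(1 + x)^(2e+1) has vanishing middle coefficient, by the symmetry of binomial coefficients.
ratio-⊛-pow-coeff : ∀ e → (ratio ⊛ pow onePlusX (suc e ℕ.+ suc e)) (suc e) ≡ 0ℤ
ratio-⊛-pow-coeff e = begin
  (ratio ⊛ pow onePlusX (suc e ℕ.+ suc e)) (suc e)
    ≡⟨ ⊛-congˡ ratio (λ j → cong (λ n → pow onePlusX (suc n) j) (+-suc e e)) (suc e) ⟩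
  ((oneMinusX ⊛ inv onePlusX) ⊛ (pow onePlusX K ⊛ onePlusX)) (suc e)
    ≡⟨ solve 4 (λ a i p q → (a ⊕ i) ⊕ (p ⊕ q) ⊜ (a ⊕ p) ⊕ (i ⊕ q)) (λ _ → refl) oneMinusX (inv onePlusX) (pow onePlusX K) onePlusX (suc e) ⟩
  ((oneMinusX ⊛ pow onePlusX K) ⊛ (inv onePlusX ⊛ onePlusX)) (suc e)
    ≡⟨ trans (⊛-congˡ (oneMinusX ⊛ pow onePlusX K) (⊛-inverseˡ onePlusX refl) (suc e)) (⊛-identityʳ (oneMinusX ⊛ pow onePlusX K) (suc e)) ⟩
  (oneMinusX ⊛ pow onePlusX K) (suc e)
    ≡⟨ linear-⊛-suc oneMinusX (pow onePlusX K) (λ _ → refl) e ⟩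
  1ℤ * pow onePlusX K (suc e) + -1ℤ * pow onePlusX K e
    ≡⟨ cong₂ _+_ (trans (ℤₚ.*-identityˡ _) (pow-onePlusX K (suc e))) (trans (ℤₚ.-1*i≡-i _) (cong -_ (pow-onePlusX K e))) ⟩
  + (K C suc e) + - + (K C e)
    ≡⟨ cong (λ c → + (K C suc e) + - + c) symmetric ⟩
  + (K C suc e) + - + (K C suc e)
    ≡⟨ ℤₚ.+-inverseʳ (+ (K C suc e)) ⟩
  0ℤ
    ∎
  where
  K : ℕ
  K = suc (e ℕ.+ e)
  symmetric : K C e ≡ K C suc e
  symmetric = trans (nCk≡nC[n∸k] (≤-trans (m≤m+n e e) (n≤1+n _))) (cong (K C_) (m+n∸n≡m (suc e) e))

centralWeight : ℕ → ℕ → ℤ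
centralWeight k m = ((pow onePlusX (m ℕ.+ m) ⊛ ratio) ⊛ pow xOver1px² k) m

centralWeight-+ : ∀ n d → centralWeight n (n ℕ.+ d) ≡ (ratio ⊛ pow onePlusX (d ℕ.+ d)) d
centralWeight-+ n d = trans (ratio-⊛-pow-shift n d (n ℕ.+ d)) (pow-X-⊛ n d (ratio ⊛ pow onePlusX (d ℕ.+ d)))

centralWeight-diagonal : ∀ m → centralWeight m m ≡ 1ℤ
centralWeight-diagonal m = trans (cong (centralWeight m) (sym (ℕ-+-identityʳ m))) (centralWeight-+ m 0)

centralWeight-< : ∀ k m → k < m → centralWeight k m ≡ 0ℤ
centralWeight-< k m k<m with m≤n⇒∃[o]m+o≡n k<m
... | e , refl = trans (cong (centralWeight k) (sym (+-suc k e))) (trans (centralWeight-+ k (suc e)) (ratio-⊛-pow-coeff e))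

centralCoeff-ratio : ∀ h → centralCoeff (ratio ⊛ (h ∘ₚ xOver1px²)) ≗ h
centralCoeff-ratio h m = begin
  ((ratio ⊛ (h ∘ₚ xOver1px²)) ⊛ W) m
    ≡⟨ solve 3 (λ r c w → (r ⊕ c) ⊕ w ⊜ (w ⊕ r) ⊕ c) (λ _ → refl) ratio (h ∘ₚ xOver1px²) W m ⟩
  ((W ⊛ ratio) ⊛ (h ∘ₚ xOver1px²)) m
    ≡⟨ ⊛-∘ₚ xOver1px² refl (W ⊛ ratio) h m ⟩
  sumTo m (λ k → h k * centralWeight k m)
    ≡⟨ sumTo-last m _ (λ k k<m → trans (cong (h k *_) (centralWeight-< k m k<m)) (ℤₚ.*-zeroʳ (h k))) ⟩
  h m * centralWeight m m
    ≡⟨ trans (cong (h m *_) (centralWeight-diagonal m)) (ℤₚ.*-identityʳ (h m)) ⟩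
  h m
    ∎
  where
  W : PS
  W = pow onePlusX (m ℕ.+ m)

mainTheorem3 : (g : PS) → g 0 ≡ 1ℤ →
    (n : ℕ) → g n ≡ inv (ratio ⊛ (central g ∘ₚ xOver1px²)) n
mainTheorem3 g g0≡1 = inv-unique c g (c≗inv-g 0) c⊛g≗one
  where
  c : PS
  c = ratio ⊛ (central g ∘ₚ xOver1px²)
  c≗inv-g : c ≗ inv g
  c≗inv-g = centralCoeff-injective c (inv g) (λ m →
    trans (centralCoeff-ratio (central g) m) (central≗centralCoeff∘inv g g0≡1 m))
  c⊛g≗one : c ⊛ g ≗ one
  c⊛g≗one k = trans (⊛-congʳ g c≗inv-g k) (⊛-inverseˡ g g0≡1 k)
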